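{- Let $2\le n\le\omega$ and let $A,B$ be Boolean algebras. If $H\subseteq A$ and $K\subseteq B$ are $n$-independent, then $L=(H\times\{0\})\cup(\{0\}\times K)$ is $n$-independent in $A\times B$.
   Context: $X\subseteq A$ is $n$-independent ($n<\omega$) if $0\notin X$ and for all nonempty finite $F,G\subseteq X$: $\sum F\neq1$; if $\prod F=0$ then $\prod F'=0$ for some $F'\subseteq F$ with $|F'|\le n$; if $0\neq\prod F\le\sum G$ then $F\cap G\neq\emptyset$. $\omega$-independent means $0\notin X$ and the first and third conditions hold. -}

module Defs where

open import Level using (Level; _⊔_)
open import Data.Nat using (ℕ; _≤_)
open import Data.Product using (_×_; _,_; proj₁; proj₂; ∃; Σ-syntax)
open import Data.Sum using (_⊎_)
open import Data.List using (List; []; _∷_; foldr; length)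
open import Data.Empty renaming (⊥ to Empty)
open import Relation.Nullary renaming (¬_ to Not)
open import Data.Unit using (tt) renaming (⊤ to Unit)
open import Data.Unit.Polymorphic using () renaming (⊤ to Lift′)
open import Relation.Unary using (Pred)
open import Relation.Binary using (Rel)
open import Relation.Binary.Structures using (IsEquivalence)
open import Algebra.Lattice.Bundles using (BooleanAlgebra)
import Data.List.Membership.Setoid as SetoidMembership
import Data.List.Relation.Unary.All as All

data ℕω : Set where
  fin : ℕ → ℕω
  ω   : ℕω

data 2≤ : ℕω → Set where
  2≤fin : ∀ {m} → 2 ≤ m → 2≤ (fin m)
  2≤ω   : 2≤ ω

-- Subsets are predicates on the carrier; finite subsets F ⊆ X are
-- lists of elements of X (duplicates are harmless: ∑, ∏ are idempotent).

module _ {c ℓ : Level} (A : BooleanAlgebra c ℓ) where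
  open BooleanAlgebra A
  open SetoidMembership setoid using (_∈_)

  _≤A_ : Carrier → Carrier → Set ℓ
  a ≤A b = (a ∧ b) ≈ a

  ⋁ : List Carrier → Carrier
  ⋁ = foldr _∨_ ⊥

  ⋀ : List Carrier → Carrier
  ⋀ = foldr _∧_ ⊤

  NonEmpty : List Carrier → Set
  NonEmpty []      = Empty
  NonEmpty (_ ∷ _) = Unit

  _⊆L_ : List Carrier → List Carrier → Set (c ⊔ ℓ)
  F ⊆L G = All.All (λ x → x ∈ G) F

  _⊆P_ : ∀ {p} → List Carrier → Pred Carrier p → Set (c ⊔ p)
  F ⊆P X = All.All X F

  Meets : List Carrier → List Carrier → Set (c ⊔ ℓ)
  Meets F G = ∃ λ x → (x ∈ F) × (x ∈ G)

  Cond2 : ℕω → ∀ {p} → Pred Carrier p → Set (c ⊔ ℓ ⊔ p)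
  Cond2 (fin n) X =
    ∀ (F : List Carrier) → NonEmpty F → F ⊆P X →
      ⋀ F ≈ ⊥ →
      Σ[ F′ ∈ List Carrier ] (F′ ⊆L F × length F′ ≤ n × ⋀ F′ ≈ ⊥)
  Cond2 ω X = Lift′

  record Independent (n : ℕω) {p} (X : Pred Carrier p) : Set (c ⊔ ℓ ⊔ p) where
    field
      zero∉   : ∀ x → X x → Not (x ≈ ⊥)
      sum≠1   : ∀ (F : List Carrier) → NonEmpty F → F ⊆P X → Not (⋁ F ≈ ⊤)
      prod0   : Cond2 n X
      disjoint : ∀ (F G : List Carrier) → NonEmpty F → NonEmpty G →
                 F ⊆P X → G ⊆P X →
                 Not (⋀ F ≈ ⊥) → ⋀ F ≤A ⋁ G → Meets F G

module _ {a b ℓ₁ ℓ₂ : Level} (A : BooleanAlgebra a ℓ₁) (B : BooleanAlgebra b ℓ₂) where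
  private
    module A = BooleanAlgebra A
    module B = BooleanAlgebra B

  ProdBA : BooleanAlgebra (a ⊔ b) (ℓ₁ ⊔ ℓ₂)
  ProdBA = record
    { Carrier = A.Carrier × B.Carrier
    ; _≈_ = λ x y → (proj₁ x A.≈ proj₁ y) × (proj₂ x B.≈ proj₂ y)
    ; _∨_ = λ x y → (proj₁ x A.∨ proj₁ y) , (proj₂ x B.∨ proj₂ y)
    ; _∧_ = λ x y → (proj₁ x A.∧ proj₁ y) , (proj₂ x B.∧ proj₂ y)
    ; ¬_ = λ x → (A.¬ proj₁ x) , (B.¬ proj₂ x)
    ; ⊤ = A.⊤ , B.⊤
    ; ⊥ = A.⊥ , B.⊥
    ; isBooleanAlgebra = record
      { isDistributiveLattice = record
        { isLattice = record
          { isEquivalence = record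
            { refl = A.refl , B.refl
            ; sym = λ (p , q) → A.sym p , B.sym q
            ; trans = λ (p , q) (r , s) → A.trans p r , B.trans q s
            }
          ; ∨-comm = λ x y → A.∨-comm _ _ , B.∨-comm _ _
          ; ∨-assoc = λ x y z → A.∨-assoc _ _ _ , B.∨-assoc _ _ _
          ; ∨-cong = λ (p , q) (r , s) → A.∨-cong p r , B.∨-cong q s
          ; ∧-comm = λ x y → A.∧-comm _ _ , B.∧-comm _ _
          ; ∧-assoc = λ x y z → A.∧-assoc _ _ _ , B.∧-assoc _ _ _
          ; ∧-cong = λ (p , q) (r , s) → A.∧-cong p r , B.∧-cong q s
          ; absorptive = (λ x y → proj₁ A.absorptive _ _ , proj₁ B.absorptive _ _)
                       , (λ x y → proj₂ A.absorptive _ _ , proj₂ B.absorptive _ _)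
          }
        ; ∨-distrib-∧ = (λ x y z → proj₁ A.∨-distrib-∧ _ _ _ , proj₁ B.∨-distrib-∧ _ _ _)
                      , (λ x y z → proj₂ A.∨-distrib-∧ _ _ _ , proj₂ B.∨-distrib-∧ _ _ _)
        ; ∧-distrib-∨ = (λ x y z → proj₁ A.∧-distrib-∨ _ _ _ , proj₁ B.∧-distrib-∨ _ _ _)
                      , (λ x y z → proj₂ A.∧-distrib-∨ _ _ _ , proj₂ B.∧-distrib-∨ _ _ _)
        }
      ; ∨-complement = (λ x → proj₁ A.∨-complement _ , proj₁ B.∨-complement _)
                     , (λ x → proj₂ A.∨-complement _ , proj₂ B.∨-complement _)
      ; ∧-complement = (λ x → proj₁ A.∧-complement _ , proj₁ B.∧-complement _)
                     , (λ x → proj₂ A.∧-complement _ , proj₂ B.∧-complement _)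
      ; ¬-cong = λ (p , q) → A.¬-cong p , B.¬-cong q
      }
    }

  Glue : ∀ {p q} → Pred A.Carrier p → Pred B.Carrier q →
         Pred (A.Carrier × B.Carrier) (p ⊔ q ⊔ ℓ₁ ⊔ ℓ₂)
  Glue H K (x , y) = (H x × y B.≈ B.⊥) ⊎ (x A.≈ A.⊥ × K y)

-- Every element of L lies on one of the two
-- "axes" of A × B, and the proof is a reduction to the independence of H
-- (resp. K) along the projection onto the corresponding coordinate:
--   * a finite F ⊆ L meeting both axes has ⋀F = 0, witnessed already by two
--     of its elements (this is where n ≥ 2 is used);
--   * if F lies on one axis, then meets, joins and membership in F are
--     computed in that coordinate, and conditions (ii), (iii) for F follow
--     from those of H (resp. K); the other half of G ⊆ L is invisible in
--     that coordinate, since it projects to 0.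
-- To treat both axes by one argument, the file develops a single module
-- `Coordinate.Projection` for an abstract product decomposition P ≅ C × D
-- given by projections π, ρ, with an independent set X ⊆ C on the π-axis and
-- Y ⊆ D on the ρ-axis.

module Submission where

open import Defs
open import Level using (Level)
open import Relation.Unary using (Pred)
open import Algebra.Lattice.Bundles using (BooleanAlgebra)

open import Data.Nat using (suc; _≤_)
open import Data.Product using (_×_; _,_; proj₁; proj₂; Σ-syntax; swap)
open import Data.Sum using (_⊎_; inj₁; inj₂) renaming (swap to ⊎-swap)
open import Data.List using (List; []; _∷_; map; length)
open import Data.List.Relation.Unary.All as All using (All; []; _∷_)
open import Data.List.Relation.Unary.Any as Any using (Any; here; there)
open import Data.List.Relation.Unary.Any.Properties using (map⁺)
open import Data.List.Relation.Unary.All.Properties using () renaming (map⁺ to All-map⁺)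
open import Data.Empty using (⊥-elim)
open import Data.Unit using (tt)
open import Relation.Nullary using (¬_)
open import Relation.Binary.PropositionalEquality as ≡ using (_≡_)
import Algebra.Lattice.Properties.BooleanAlgebra as BooleanAlgebraProperties
import Data.List.Membership.Setoid as Membership
import Data.List.Membership.Setoid.Properties as MembershipProperties
import Relation.Binary.Reasoning.Setoid as SetoidReasoning

all-or-any : ∀ {a p q} {T : Set a} {P : Pred T p} {Q : Pred T q} {xs : List T} →
             All (λ x → P x ⊎ Q x) xs → All P xs ⊎ Any Q xs
all-or-any []            = inj₁ []
all-or-any (inj₂ q ∷ _)  = inj₂ (here q)
all-or-any (inj₁ p ∷ pqs) with all-or-any pqs
... | inj₁ ps = inj₁ (p ∷ ps)
... | inj₂ qs = inj₂ (there qs)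

module FiniteMeets {c ℓ} (C : BooleanAlgebra c ℓ) where
  open BooleanAlgebra C
  open BooleanAlgebraProperties C using (∧-zeroˡ; ∧-zeroʳ)

  ⋀-absorbing : ∀ {F} → Any (_≈ ⊥) F → ⋀ C F ≈ ⊥
  ⋀-absorbing (here x≈⊥)  = trans (∧-cong x≈⊥ refl) (∧-zeroˡ _)
  ⋀-absorbing (there any) = trans (∧-cong refl (⋀-absorbing any)) (∧-zeroʳ _)

module Homomorphic {p ℓp c ℓc} (P : BooleanAlgebra p ℓp) (C : BooleanAlgebra c ℓc)
                   (f : BooleanAlgebra.Carrier P → BooleanAlgebra.Carrier C) where
  private
    module P = BooleanAlgebra P
    module C = BooleanAlgebra C

  map-⋀ : (∀ u v → f (u P.∧ v) ≡ f u C.∧ f v) → f P.⊤ ≡ C.⊤ →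
          ∀ F → f (⋀ P F) ≡ ⋀ C (map f F)
  map-⋀ f-∧ f-⊤ []      = f-⊤
  map-⋀ f-∧ f-⊤ (u ∷ F) = ≡.trans (f-∧ u (⋀ P F)) (≡.cong (f u C.∧_) (map-⋀ f-∧ f-⊤ F))

  map-⋁ : (∀ u v → f (u P.∨ v) ≡ f u C.∨ f v) → f P.⊥ ≡ C.⊥ →
          ∀ F → f (⋁ P F) ≡ ⋁ C (map f F)
  map-⋁ f-∨ f-⊥ []      = f-⊥
  map-⋁ f-∨ f-⊥ (u ∷ F) = ≡.trans (f-∨ u (⋁ P F)) (≡.cong (f u C.∨_) (map-⋁ f-∨ f-⊥ F))

module Independence {c ℓ r} (C : BooleanAlgebra c ℓ)
                    {X : Pred (BooleanAlgebra.Carrier C) r} where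
  open BooleanAlgebra C hiding (¬_)
  open BooleanAlgebraProperties C using (∧-zeroʳ; ∧-identityʳ)
  open Membership setoid using (_∈_)

  ⊤≉⊥ : ∀ {x} → ¬ (x ≈ ⊥) → ¬ (⊤ ≈ ⊥)
  ⊤≉⊥ {x} x≉⊥ ⊤≈⊥ = x≉⊥ (trans (sym (∧-identityʳ x)) (trans (∧-cong refl ⊤≈⊥) (∧-zeroʳ x)))

  -- Condition (iii) also holds for G = ∅: then ⋀F ≤ ⊥ forces ⋀F = ⊥.
  meets-of-≤ : ∀ {n} → Independent C n X → ∀ F G → NonEmpty C F → _⊆P_ C F X → _⊆P_ C G X →
               ¬ (⋀ C F ≈ ⊥) → _≤A_ C (⋀ C F) (⋁ C G) → Meets C F G
  meets-of-≤ ind F []      neF FX GX ⋀F≉⊥ F≤G = ⊥-elim (⋀F≉⊥ (trans (sym F≤G) (∧-zeroʳ _)))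
  meets-of-≤ ind F (g ∷ G) neF FX GX        = Independent.disjoint ind F (g ∷ G) neF tt FX GX

  -- Condition (ii) with a nonempty witness: an empty one would give ⊤ ≈ ⊥,
  -- contradicting that the elements of F are nonzero.
  small-zero-meet : ∀ {m} → Independent C (fin m) X → ∀ F → NonEmpty C F → _⊆P_ C F X →
                    ⋀ C F ≈ ⊥ →
                    Σ[ F′ ∈ List Carrier ] (NonEmpty C F′ × All (_∈ F) F′ × length F′ ≤ m × ⋀ C F′ ≈ ⊥)
  small-zero-meet ind (x ∷ F) _ FX ⋀F≈⊥ with Independent.prod0 ind (x ∷ F) tt FX ⋀F≈⊥
  ... | [] , _ , _ , ⊤≈⊥ =
    ⊥-elim (⊤≉⊥ (Independent.zero∉ ind x (All.head FX)) ⊤≈⊥)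
  ... | x′ ∷ F′ , F′⊆F , small , ⋀F′≈⊥ = x′ ∷ F′ , tt , F′⊆F , small , ⋀F′≈⊥

module Coordinate {p ℓp c ℓc d ℓd} (P : BooleanAlgebra p ℓp)
                  (C : BooleanAlgebra c ℓc) (D : BooleanAlgebra d ℓd) where
  private
    module P = BooleanAlgebra P
    module C = BooleanAlgebra C
    module D = BooleanAlgebra D

  module Projection
    (π : P.Carrier → C.Carrier) (ρ : P.Carrier → D.Carrier)
    (π-∧ : ∀ u v → π (u P.∧ v) ≡ π u C.∧ π v) (π-⊤ : π P.⊤ ≡ C.⊤)
    (π-∨ : ∀ u v → π (u P.∨ v) ≡ π u C.∨ π v) (π-⊥ : π P.⊥ ≡ C.⊥)
    (ρ-∧ : ∀ u v → ρ (u P.∧ v) ≡ ρ u D.∧ ρ v) (ρ-⊤ : ρ P.⊤ ≡ D.⊤) (ρ-⊥ : ρ P.⊥ ≡ D.⊥)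
    (π-cong : ∀ {u v} → u P.≈ v → π u C.≈ π v)
    (≈-intro : ∀ {u v} → π u C.≈ π v → ρ u D.≈ ρ v → u P.≈ v)
    {r s} (X : Pred C.Carrier r) (Y : Pred D.Carrier s)
    where

    open Membership P.setoid using (find) renaming (_∈_ to _∈P_)
    open Membership C.setoid using () renaming (_∈_ to _∈C_)
    open MembershipProperties using (∈-resp-≈)
    open FiniteMeets using (⋀-absorbing)
    open Independence C {X = X} using (meets-of-≤; small-zero-meet)

    OnAxis : Pred P.Carrier _
    OnAxis u = X (π u) × ρ u D.≈ D.⊥

    OffAxis : Pred P.Carrier _
    OffAxis u = π u C.≈ C.⊥ × Y (ρ u)

    Member : Pred P.Carrier _
    Member u = OnAxis u ⊎ OffAxis u

    π-⋀ : ∀ F → π (⋀ P F) ≡ ⋀ C (map π F)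
    π-⋀ = Homomorphic.map-⋀ P C π π-∧ π-⊤

    π-⋁ : ∀ F → π (⋁ P F) ≡ ⋁ C (map π F)
    π-⋁ = Homomorphic.map-⋁ P C π π-∨ π-⊥

    zero-intro : ∀ {u} → π u C.≈ C.⊥ → ρ u D.≈ D.⊥ → u P.≈ P.⊥
    zero-intro πu≈⊥ ρu≈⊥ =
      ≈-intro (C.trans πu≈⊥ (C.reflexive (≡.sym π-⊥))) (D.trans ρu≈⊥ (D.reflexive (≡.sym ρ-⊥)))

    π-⋀-absorbing : ∀ {F} → Any (λ u → π u C.≈ C.⊥) F → π (⋀ P F) C.≈ C.⊥
    π-⋀-absorbing {F} any =
      C.trans (C.reflexive (π-⋀ F)) (⋀-absorbing C (map⁺ any))

    ρ-⋀-absorbing : ∀ {F} → Any (λ u → ρ u D.≈ D.⊥) F → ρ (⋀ P F) D.≈ D.⊥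
    ρ-⋀-absorbing {F} any =
      D.trans (D.reflexive (Homomorphic.map-⋀ P D ρ ρ-∧ ρ-⊤ F)) (⋀-absorbing D (map⁺ any))

    onAxis-zero : ∀ {F} → NonEmpty P F → All OnAxis F → ⋀ C (map π F) C.≈ C.⊥ → ⋀ P F P.≈ P.⊥
    onAxis-zero {u ∷ F} _ (on ∷ _) ⋀πF≈⊥ =
      zero-intro (C.trans (C.reflexive (π-⋀ (u ∷ F))) ⋀πF≈⊥) (ρ-⋀-absorbing {u ∷ F} (here (proj₂ on)))

    mixed-zero : ∀ {F} → Any OnAxis F → Any OffAxis F → ⋀ P F P.≈ P.⊥
    mixed-zero on off =
      zero-intro (π-⋀-absorbing (Any.map proj₁ off))
                 (ρ-⋀-absorbing (Any.map proj₂ on))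

    mixed-pair : ∀ {F} → Any OnAxis F → Any OffAxis F →
                 Σ[ F′ ∈ List P.Carrier ] (All (_∈P F) F′ × length F′ ≡ 2 × ⋀ P F′ P.≈ P.⊥)
    mixed-pair on off with find on | find off
    ... | u , u∈F , u-on | v , v∈F , v-off =
      u ∷ v ∷ [] , u∈F ∷ v∈F ∷ [] , ≡.refl , mixed-zero {u ∷ v ∷ []} (here u-on) (there (here v-off))

    classify : ∀ {F} → All Member F →
               All OnAxis F ⊎ All OffAxis F ⊎ (Any OnAxis F × Any OffAxis F)
    classify ms with all-or-any ms | all-or-any (All.map ⊎-swap ms)
    ... | inj₁ all-on | _            = inj₁ all-on
    ... | inj₂ _      | inj₁ all-off = inj₂ (inj₁ all-off)
    ... | inj₂ off    | inj₂ on      = inj₂ (inj₂ (on , off))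

    onAxis-≈ : ∀ {u v} → ρ u D.≈ D.⊥ → ρ v D.≈ D.⊥ → π u C.≈ π v → u P.≈ v
    onAxis-≈ ρu≈⊥ ρv≈⊥ πu≈πv = ≈-intro πu≈πv (D.trans ρu≈⊥ (D.sym ρv≈⊥))

    preimage : ∀ {F x} → x ∈C map π F → P.Carrier
    preimage {u ∷ _} (here _)   = u
    preimage {_ ∷ _} (there x∈) = preimage x∈

    preimage-∈ : ∀ {F x} (x∈ : x ∈C map π F) → preimage x∈ ∈P F
    preimage-∈ {_ ∷ _} (here _)   = here P.refl
    preimage-∈ {_ ∷ _} (there x∈) = there (preimage-∈ x∈)

    preimage-π : ∀ {F x} (x∈ : x ∈C map π F) → x C.≈ π (preimage x∈)
    preimage-π {_ ∷ _} (here x≈πu) = x≈πu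
    preimage-π {_ ∷ _} (there x∈)  = preimage-π x∈

    preimage-ρ : ∀ {F x} → All OnAxis F → (x∈ : x ∈C map π F) → ρ (preimage x∈) D.≈ D.⊥
    preimage-ρ (on ∷ _)  (here _)   = proj₂ on
    preimage-ρ (_ ∷ ons) (there x∈) = preimage-ρ ons x∈

    -- The π-coordinates of the on-axis members of G; the off-axis members
    -- project to ⊥ and do not contribute to the join.
    onPart : ∀ G → All Member G → List C.Carrier
    onPart []      []            = []
    onPart (u ∷ G) (inj₁ _ ∷ ms) = π u ∷ onPart G ms
    onPart (u ∷ G) (inj₂ _ ∷ ms) = onPart G ms

    onPart⊆X : ∀ G ms → _⊆P_ C (onPart G ms) X
    onPart⊆X []      []             = []
    onPart⊆X (u ∷ G) (inj₁ on ∷ ms) = proj₁ on ∷ onPart⊆X G ms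
    onPart⊆X (u ∷ G) (inj₂ _  ∷ ms) = onPart⊆X G ms

    ⋁-onPart : ∀ G ms → ⋁ C (map π G) C.≈ ⋁ C (onPart G ms)
    ⋁-onPart []      []              = C.refl
    ⋁-onPart (u ∷ G) (inj₁ _   ∷ ms) = C.∨-cong C.refl (⋁-onPart G ms)
    ⋁-onPart (u ∷ G) (inj₂ off ∷ ms) =
      C.trans (C.∨-cong (proj₁ off) (⋁-onPart G ms)) (BooleanAlgebraProperties.∨-identityˡ C _)

    onPart-∈ : ∀ G ms {u} → π u ∈C onPart G ms → ρ u D.≈ D.⊥ → u ∈P G
    onPart-∈ (v ∷ G) (inj₁ on ∷ ms) (here πu≈πv) ρu≈⊥ = here (onAxis-≈ ρu≈⊥ (proj₂ on) πu≈πv)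
    onPart-∈ (v ∷ G) (inj₁ _  ∷ ms) (there πu∈G) ρu≈⊥ = there (onPart-∈ G ms πu∈G ρu≈⊥)
    onPart-∈ (v ∷ G) (inj₂ _  ∷ ms) πu∈G         ρu≈⊥ = there (onPart-∈ G ms πu∈G ρu≈⊥)

    onAxis-nonzero : ∀ {n u} → Independent C n X → OnAxis u → ¬ (u P.≈ P.⊥)
    onAxis-nonzero ind on u≈⊥ =
      Independent.zero∉ ind _ (proj₁ on) (C.trans (π-cong u≈⊥) (C.reflexive π-⊥))

    -- Condition "∑G ≠ 1" for families of members with an on-axis element:
    -- the π-coordinate of ⋁G is a join of elements of X.
    onAxis-sum≠⊤ : ∀ {n} → Independent C n X → ∀ u G → OnAxis u → (ms : All Member G) →
                   ¬ (⋁ P (u ∷ G) P.≈ P.⊤)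
    onAxis-sum≠⊤ ind u G on ms ⋁≈⊤ =
      Independent.sum≠1 ind (onPart (u ∷ G) (inj₁ on ∷ ms)) tt (onPart⊆X (u ∷ G) (inj₁ on ∷ ms))
        (begin
          ⋁ C (onPart (u ∷ G) (inj₁ on ∷ ms)) ≈⟨ ⋁-onPart (u ∷ G) (inj₁ on ∷ ms) ⟨
          ⋁ C (map π (u ∷ G))                 ≡⟨ π-⋁ (u ∷ G) ⟨
          π (⋁ P (u ∷ G))                     ≈⟨ π-cong ⋁≈⊤ ⟩
          π P.⊤                               ≡⟨ π-⊤ ⟩
          C.⊤                                 ∎)
      where open SetoidReasoning C.setoid

    π-≤ : ∀ F G ms → _≤A_ P (⋀ P F) (⋁ P G) → _≤A_ C (⋀ C (map π F)) (⋁ C (onPart G ms))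
    π-≤ F G ms F≤G = begin
      ⋀ C (map π F) C.∧ ⋁ C (onPart G ms) ≈⟨ C.∧-cong C.refl (⋁-onPart G ms) ⟨
      ⋀ C (map π F) C.∧ ⋁ C (map π G)     ≡⟨ ≡.cong₂ C._∧_ (π-⋀ F) (π-⋁ G) ⟨
      π (⋀ P F) C.∧ π (⋁ P G)             ≡⟨ π-∧ (⋀ P F) (⋁ P G) ⟨
      π (⋀ P F P.∧ ⋁ P G)                 ≈⟨ π-cong F≤G ⟩
      π (⋀ P F)                           ≡⟨ π-⋀ F ⟩
      ⋀ C (map π F)                       ∎
      where open SetoidReasoning C.setoid

    nonEmpty-map : ∀ {F} → NonEmpty P F → NonEmpty C (map π F)
    nonEmpty-map {_ ∷ _} _ = tt

    onAxis-meets : ∀ {n} → Independent C n X → ∀ F G → NonEmpty P F → All OnAxis F →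
                   (ms : All Member G) → ¬ (⋀ P F P.≈ P.⊥) → _≤A_ P (⋀ P F) (⋁ P G) → Meets P F G
    onAxis-meets ind F G neF ons ms ⋀F≉⊥ F≤G
      with meets-of-≤ ind (map π F) (onPart G ms) (nonEmpty-map neF) (All-map⁺ (All.map proj₁ ons))
                      (onPart⊆X G ms) (λ ⋀πF≈⊥ → ⋀F≉⊥ (onAxis-zero neF ons ⋀πF≈⊥)) (π-≤ F G ms F≤G)
    ... | x , x∈πF , x∈onPart =
      preimage x∈πF , preimage-∈ x∈πF ,
      onPart-∈ G ms (∈-resp-≈ C.setoid (preimage-π x∈πF) x∈onPart) (preimage-ρ ons x∈πF)

    lift : ∀ {F F′} → All (_∈C map π F) F′ → List P.Carrier
    lift []         = []
    lift (x∈ ∷ x∈s) = preimage x∈ ∷ lift x∈s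

    lift⊆ : ∀ {F F′} (x∈s : All (_∈C map π F) F′) → All (_∈P F) (lift x∈s)
    lift⊆ []         = []
    lift⊆ (x∈ ∷ x∈s) = preimage-∈ x∈ ∷ lift⊆ x∈s

    lift-length : ∀ {F F′} (x∈s : All (_∈C map π F) F′) → length (lift x∈s) ≡ length F′
    lift-length []         = ≡.refl
    lift-length (_ ∷ x∈s) = ≡.cong suc (lift-length x∈s)

    lift-π : ∀ {F F′} (x∈s : All (_∈C map π F) F′) → ⋀ C F′ C.≈ ⋀ C (map π (lift x∈s))
    lift-π []         = C.refl
    lift-π (x∈ ∷ x∈s) = C.∧-cong (preimage-π x∈) (lift-π x∈s)

    lift-zero : ∀ {F F′} → All OnAxis F → NonEmpty C F′ → (x∈s : All (_∈C map π F) F′) →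
                ⋀ C F′ C.≈ C.⊥ → ⋀ P (lift x∈s) P.≈ P.⊥
    lift-zero {F′ = _ ∷ _} ons _ x∈s@(x∈ ∷ _) ⋀F′≈⊥ =
      zero-intro (C.trans (C.reflexive (π-⋀ (lift x∈s))) (C.trans (C.sym (lift-π x∈s)) ⋀F′≈⊥))
                 (ρ-⋀-absorbing {lift x∈s} (here (preimage-ρ ons x∈)))

    onAxis-small-zero : ∀ {m} → Independent C (fin m) X → ∀ F → NonEmpty P F → All OnAxis F →
                        ⋀ P F P.≈ P.⊥ →
                        Σ[ F′ ∈ List P.Carrier ] (All (_∈P F) F′ × length F′ ≤ m × ⋀ P F′ P.≈ P.⊥)
    onAxis-small-zero {m} ind F neF ons ⋀F≈⊥
      with small-zero-meet ind (map π F) (nonEmpty-map neF) (All-map⁺ (All.map proj₁ ons))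
                           (C.trans (C.reflexive (≡.sym (π-⋀ F)))
                                    (C.trans (π-cong ⋀F≈⊥) (C.reflexive π-⊥)))
    ... | F′ , neF′ , x∈s , small , ⋀F′≈⊥ =
      lift x∈s , lift⊆ x∈s , ≡.subst (_≤ m) (≡.sym (lift-length x∈s)) small ,
      lift-zero ons neF′ x∈s ⋀F′≈⊥

module Glued {a b ℓ₁ ℓ₂ p q : Level} (A : BooleanAlgebra a ℓ₁) (B : BooleanAlgebra b ℓ₂)
             (H : Pred (BooleanAlgebra.Carrier A) p) (K : Pred (BooleanAlgebra.Carrier B) q) where
  P : BooleanAlgebra _ _
  P = ProdBA A B

  L : Pred (BooleanAlgebra.Carrier P) _
  L = Glue A B H K

  private
    module P = BooleanAlgebra P

  module First = Coordinate.Projection P A B proj₁ proj₂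
    (λ _ _ → ≡.refl) ≡.refl (λ _ _ → ≡.refl) ≡.refl (λ _ _ → ≡.refl) ≡.refl ≡.refl
    proj₁ _,_ H K

  module Second = Coordinate.Projection P B A proj₂ proj₁
    (λ _ _ → ≡.refl) ≡.refl (λ _ _ → ≡.refl) ≡.refl (λ _ _ → ≡.refl) ≡.refl ≡.refl
    proj₂ (λ πu≈πv ρu≈ρv → ρu≈ρv , πu≈πv) K H

  -- L is the set of members in the first view, and in the second one up to
  -- exchanging the two halves.
  L⇒Second : ∀ {u} → L u → Second.Member u
  L⇒Second (inj₁ h×0) = inj₂ (swap h×0)
  L⇒Second (inj₂ 0×k) = inj₁ (swap 0×k)

  module _ {n : ℕω} (indH : Independent A n H) (indK : Independent B n K) where

    nonzero : ∀ u → L u → ¬ (u P.≈ P.⊥)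
    nonzero u (inj₁ h×0) = First.onAxis-nonzero indH h×0
    nonzero u (inj₂ 0×k) = Second.onAxis-nonzero indK (swap 0×k)

    sum≠⊤ : ∀ G → NonEmpty P G → _⊆P_ P G L → ¬ (⋁ P G P.≈ P.⊤)
    sum≠⊤ (u ∷ G) _ (inj₁ h×0 ∷ Ls) = First.onAxis-sum≠⊤ indH u G h×0 Ls
    sum≠⊤ (u ∷ G) _ (inj₂ 0×k ∷ Ls) = Second.onAxis-sum≠⊤ indK u G (swap 0×k) (All.map L⇒Second Ls)

    meets : ∀ F G → NonEmpty P F → NonEmpty P G → _⊆P_ P F L → _⊆P_ P G L →
            ¬ (⋀ P F P.≈ P.⊥) → _≤A_ P (⋀ P F) (⋁ P G) → Meets P F G
    meets F G neF _ LF LG ⋀F≉⊥ F≤G with First.classify LF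
    ... | inj₁ onH             = First.onAxis-meets indH F G neF onH LG ⋀F≉⊥ F≤G
    ... | inj₂ (inj₁ onK)      =
      Second.onAxis-meets indK F G neF (All.map swap onK) (All.map L⇒Second LG) ⋀F≉⊥ F≤G
    ... | inj₂ (inj₂ (on , off)) = ⊥-elim (⋀F≉⊥ (First.mixed-zero on off))

  small-zero : ∀ {n} → 2≤ n → Independent A n H → Independent B n K → Cond2 P n L
  small-zero 2≤ω _ _ = _
  small-zero {fin m} (2≤fin 2≤m) indH indK F neF LF ⋀F≈⊥ with First.classify LF
  ... | inj₁ onH               = First.onAxis-small-zero indH F neF onH ⋀F≈⊥
  ... | inj₂ (inj₁ onK)        = Second.onAxis-small-zero indK F neF (All.map swap onK) ⋀F≈⊥
  ... | inj₂ (inj₂ (on , off)) with First.mixed-pair on off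
  ...   | F′ , F′⊆F , ∣F′∣≡2 , ⋀F′≈⊥ = F′ , F′⊆F , ≡.subst (_≤ m) (≡.sym ∣F′∣≡2) 2≤m , ⋀F′≈⊥

mainTheorem11 : ∀ {a b ℓ₁ ℓ₂ p q : Level} (n : ℕω) → 2≤ n →
    (A : BooleanAlgebra a ℓ₁) (B : BooleanAlgebra b ℓ₂) →
    (H : Pred (BooleanAlgebra.Carrier A) p) (K : Pred (BooleanAlgebra.Carrier B) q) →
    Independent A n H → Independent B n K →
    Independent (ProdBA A B) n (Glue A B H K)
mainTheorem11 n 2≤n A B H K indH indK = record
  { zero∉    = nonzero indH indK
  ; sum≠1    = sum≠⊤ indH indK
  ; prod0    = small-zero 2≤n indH indK
  ; disjoint = meets indH indK
  }
  where open Glued A B H K
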